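{- Let $n$ be even and let $F_1,\dots,F_k$ be binary frequency squares of order $n$. Let $\mathcal{R}$ be a partition of the row indices $\{0,\dots,n-1\}$ into pairs. Suppose that for each $\{r_1,r_2\}\in\mathcal{R}$ there exists an equipartition $\mathcal{P}$ of the column set $\{0,\dots,n-1\}$ which is good with respect to row $r_i$ and square $F_j$ for every $i\in\{1,2\}$ and every $1\le j\le k$. Then there exists a binary frequency square $F'$ of order $n$ orthogonal to each of $F_1,\dots,F_k$.
   Context: A binary frequency square of order $n$ is an $n\times n$ $\{0,1\}$-array with $n/2$ zeros and $n/2$ ones in each row and each column; two such squares are orthogonal if, superimposed, each ordered pair in $\{0,1\}^2$ occurs $n^2/4$ times. An equipartition of a set is a partition into parts of equal size. An equipartition $\mathcal{P}$ of the columns is good with respect to row $r$ and square $F_j$ if (a) $|\mathcal{P}|$ is even and each part of $\mathcal{P}$ has even cardinality, and (b) for each $P\in\mathcal{P}$, the number of columns $c\in P$ with $F_j[r,c]=1$ equals $|P|/2$. -}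

module Defs where

open import Data.Nat using (ℕ; zero; suc; _+_; _*_; _<_)
open import Data.Nat.DivMod using (_/_)
open import Data.Nat.Divisibility using (_∣_)
open import Data.Bool using (Bool; true; false; _∧_; not; if_then_else_)
open import Data.Bool.Properties using () renaming (_≟_ to _≟ᵇ_)
open import Data.Fin using (Fin; zero; suc; _≟_)
open import Data.Product using (_×_; ∃-syntax)
open import Relation.Nullary.Decidable using (⌊_⌋)
open import Relation.Binary.PropositionalEquality using (_≡_; _≢_)

count : ∀ {n} → (Fin n → Bool) → ℕ
count {zero}  f = 0
count {suc n} f = (if f zero then 1 else 0) + count (λ i → f (suc i))

count₂ : ∀ {m n} → (Fin m → Fin n → Bool) → ℕ
count₂ {zero}  f = 0
count₂ {suc m} f = count (f zero) + count₂ (λ r → f (suc r))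

-- an n × n {0,1}-array; F r c is the entry in row r, column c (true = 1, false = 0)
Square : ℕ → Set
Square n = Fin n → Fin n → Bool

IsBFS : ∀ n → Square n → Set
IsBFS n F =
  (∀ r → count (λ c → F r c) ≡ n / 2 × count (λ c → not (F r c)) ≡ n / 2) ×
  (∀ c → count (λ r → F r c) ≡ n / 2 × count (λ r → not (F r c)) ≡ n / 2)

Orthogonal : ∀ n → Square n → Square n → Set
Orthogonal n F G = ∀ (a b : Bool) →
  count₂ (λ r c → ⌊ F r c ≟ᵇ a ⌋ ∧ ⌊ G r c ≟ᵇ b ⌋) ≡ (n * n) / 4

-- an equipartition of the column set Fin n: a surjective labelling of the columns
-- by part indices Fin numParts, each part having exactly partSize (≥ 1) elements
record Equipartition (n : ℕ) : Set where
  field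
    numParts : ℕ
    part     : Fin n → Fin numParts
    partSize : ℕ
    nonempty : 0 < partSize
    sizes    : ∀ (i : Fin numParts) → count (λ c → ⌊ part c ≟ i ⌋) ≡ partSize

Good : ∀ {n} → Equipartition n → Fin n → Square n → Set
Good {n} P r F =
  2 ∣ numParts × 2 ∣ partSize ×
  (∀ (i : Fin numParts) → count (λ c → ⌊ part c ≟ i ⌋ ∧ F r c) ≡ partSize / 2)
  where open Equipartition P

-- a partition of the rows into pairs, given as a fixed-point-free involution σ;
-- the pairs are {r , σ r}
IsPairing : ∀ {n} → (Fin n → Fin n) → Set
IsPairing σ = (∀ r → σ (σ r) ≡ r) × (∀ r → σ r ≢ r)

-- Inside each pair {r , σ r} of rows, let h be the row that is 1 exactly on the columns of the
-- first half of the parts of the given good equipartition P.  Every part meets the 1s of row r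
-- of F_j in half of its columns, so h ∧ (row r of F_j) has n/4 ones, and h and that row each
-- have n/2 ones; by inclusion–exclusion every pair of values then occurs n/4 times along the row.
-- The same holds for row σ r, and also for the complement of h.  Put h in one row of the pair
-- and its complement in the other: every row is balanced and orthogonal to the corresponding
-- rows of all F_j, and every column is balanced because σ swaps its 1s and 0s.
module Submission where

open import Defs
open import Data.Nat using (ℕ; zero; suc; _+_; _*_; _≤_; s≤s; _<ᵇ_; NonZero)
open import Data.Nat.Properties using (+-cancelˡ-≡; +-suc; +-identityʳ; *-comm; *-assoc; +-*-semiring)
open import Data.Nat.DivMod using (_/_; m*n/n≡m; m/n≤m; *-/-assoc)
open import Data.Nat.Divisibility using (_∣_; divides; _∣0)
open import Data.Nat.Tactic.RingSolver using (solve-∀)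
open import Data.Bool using (Bool; true; false; _∧_; not; if_then_else_)
open import Data.Bool.Properties using (∧-zeroʳ; ∧-identityʳ; ∧-comm; not-involutive)
  renaming (_≟_ to _≟ᵇ_)
open import Data.Fin using (Fin; zero; suc; _≟_; toℕ)
open import Data.Fin.Properties using (toℕ-injective)
open import Data.Fin.Permutation using (permutation)
open import Data.Product using (_×_; ∃-syntax; _,_; proj₁; proj₂)
open import Data.Empty using (⊥-elim)
open import Function using (_∘_)
open import Relation.Nullary using (yes; no)
open import Relation.Nullary.Decidable using (⌊_⌋)
open import Relation.Binary.PropositionalEquality hiding ([_])
open import Algebra.Properties.Semiring.Sum +-*-semiring
  using (sum; sum-syntax; sum-cong-≗; ∑-comm; *-distribʳ-sum; sum-permute)

open ≡-Reasoning

private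
  variable
    m n N q : ℕ

[_] : Bool → ℕ
[ b ] = if b then 1 else 0

_is_ : Bool → Bool → Bool
x is true  = x
x is false = not x

≟ᵇ-is : ∀ x a → ⌊ x ≟ᵇ a ⌋ ≡ x is a
≟ᵇ-is false false = refl
≟ᵇ-is false true  = refl
≟ᵇ-is true  false = refl
≟ᵇ-is true  true  = refl

not-≟ᵇ : ∀ x a → ⌊ not x ≟ᵇ a ⌋ ≡ ⌊ x ≟ᵇ not a ⌋
not-≟ᵇ false false = refl
not-≟ᵇ false true  = refl
not-≟ᵇ true  false = refl
not-≟ᵇ true  true  = refl

<ᵇ-flip : ∀ x y → x ≢ y → (y <ᵇ x) ≡ not (x <ᵇ y)
<ᵇ-flip zero    zero    x≢y = ⊥-elim (x≢y refl)
<ᵇ-flip zero    (suc y) _   = refl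
<ᵇ-flip (suc x) zero    _   = refl
<ᵇ-flip (suc x) (suc y) x≢y = <ᵇ-flip x y (x≢y ∘ cong suc)

*2≡+ : ∀ q → q * 2 ≡ q + q
*2≡+ = solve-∀

m≡q*d⇒m/d≡q : ∀ {m} q {d} .{{_ : NonZero d}} → m ≡ q * d → m / d ≡ q
m≡q*d⇒m/d≡q q {d} refl = m*n/n≡m q d

inhabited-∣ : ∀ {d} → (Fin n → d ∣ n) → d ∣ n
inhabited-∣ {zero}  {d} _   = d ∣0
inhabited-∣ {suc n} d∣n     = d∣n zero

count-cong : {f g : Fin n → Bool} → (∀ i → f i ≡ g i) → count f ≡ count g
count-cong {zero}  _   = refl
count-cong {suc n} f≗g = cong₂ _+_ (cong [_] (f≗g zero)) (count-cong (f≗g ∘ suc))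

count-false : count {n} (λ _ → false) ≡ 0
count-false {zero}  = refl
count-false {suc n} = count-false {n}

count-true : count {n} (λ _ → true) ≡ n
count-true {zero}  = refl
count-true {suc n} = cong suc (count-true {n})

count-sum : (f : Fin n → Bool) → count f ≡ sum (λ i → [ f i ])
count-sum {zero}  f = refl
count-sum {suc n} f = cong ([ f zero ] +_) (count-sum (f ∘ suc))

count-∧-split : (f g : Fin n → Bool) →
  count f ≡ count (λ c → f c ∧ g c) + count (λ c → f c ∧ not (g c))
count-∧-split {zero}  f g = refl
count-∧-split {suc n} f g with f zero | g zero
... | false | _     = count-∧-split (f ∘ suc) (g ∘ suc)
... | true  | true  = cong suc (count-∧-split (f ∘ suc) (g ∘ suc))
... | true  | false = trans (cong suc (count-∧-split (f ∘ suc) (g ∘ suc))) (sym (+-suc _ _))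

count-∧ˡ : ∀ b (f : Fin n → Bool) → count (λ c → b ∧ f c) ≡ [ b ] * count f
count-∧ˡ true  f = sym (+-identityʳ (count f))
count-∧ˡ {n} false f = count-false {n}

count-≟ : (x : Fin n) → count (λ i → ⌊ x ≟ i ⌋) ≡ 1
count-≟ {suc n} zero    = cong suc (count-false {n})
count-≟ {suc n} (suc x) = trans (count-cong (λ i → ≟-suc i)) (count-≟ x)
  where
  ≟-suc : ∀ i → ⌊ suc x ≟ suc i ⌋ ≡ ⌊ x ≟ i ⌋
  ≟-suc i with x ≟ i
  ... | yes _ = refl
  ... | no  _ = refl

count-<ᵇ : m ≤ N → count {N} (λ i → toℕ i <ᵇ m) ≡ m
count-<ᵇ {zero}  {N}     _         = count-false {N}
count-<ᵇ {suc m} {suc N} (s≤s m≤N) = cong suc (count-<ᵇ m≤N)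

count-fibres : (p : Fin n → Fin N) (f : Fin n → Bool) →
  count f ≡ ∑[ i < N ] count (λ c → ⌊ p c ≟ i ⌋ ∧ f c)
count-fibres {n} {N} p f = begin
  count f                                                ≡⟨ count-sum f ⟩
  ∑[ c < n ] [ f c ]                                      ≡⟨ sum-cong-≗ (λ c → sym (indicator c)) ⟩
  ∑[ c < n ] ∑[ i < N ] [ ⌊ p c ≟ i ⌋ ∧ f c ]             ≡⟨ ∑-comm (λ c i → [ ⌊ p c ≟ i ⌋ ∧ f c ]) ⟩
  ∑[ i < N ] ∑[ c < n ] [ ⌊ p c ≟ i ⌋ ∧ f c ]             ≡⟨ sum-cong-≗ (λ i → sym (count-sum (λ c → ⌊ p c ≟ i ⌋ ∧ f c))) ⟩
  ∑[ i < N ] count (λ c → ⌊ p c ≟ i ⌋ ∧ f c)              ∎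
  where
  indicator : ∀ c → ∑[ i < N ] [ ⌊ p c ≟ i ⌋ ∧ f c ] ≡ [ f c ]
  indicator c = begin
    ∑[ i < N ] [ ⌊ p c ≟ i ⌋ ∧ f c ]    ≡⟨ sym (count-sum (λ i → ⌊ p c ≟ i ⌋ ∧ f c)) ⟩
    count (λ i → ⌊ p c ≟ i ⌋ ∧ f c)     ≡⟨ count-cong (λ i → ∧-comm ⌊ p c ≟ i ⌋ (f c)) ⟩
    count (λ i → f c ∧ ⌊ p c ≟ i ⌋)     ≡⟨ count-∧ˡ (f c) (λ i → ⌊ p c ≟ i ⌋) ⟩
    [ f c ] * count (λ i → ⌊ p c ≟ i ⌋)  ≡⟨ cong ([ f c ] *_) (count-≟ (p c)) ⟩
    [ f c ] * 1                          ≡⟨ *-comm [ f c ] 1 ⟩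
    [ f c ] + 0                          ≡⟨ +-identityʳ _ ⟩
    [ f c ]                              ∎

count-uniform-fibres : (p : Fin n → Fin N) (t : Fin N → Bool) (f : Fin n → Bool) → ∀ {y} →
  (∀ i → count (λ c → ⌊ p c ≟ i ⌋ ∧ f c) ≡ y) → count (λ c → t (p c) ∧ f c) ≡ count t * y
count-uniform-fibres {n} {N} p t f {y} fibres = begin
  count (λ c → t (p c) ∧ f c)                              ≡⟨ count-fibres p _ ⟩
  ∑[ i < N ] count (λ c → ⌊ p c ≟ i ⌋ ∧ (t (p c) ∧ f c))   ≡⟨ sum-cong-≗ (λ i → count-cong (restrict i)) ⟩
  ∑[ i < N ] count (λ c → t i ∧ (⌊ p c ≟ i ⌋ ∧ f c))       ≡⟨ sum-cong-≗ (λ i → count-∧ˡ (t i) (λ c → ⌊ p c ≟ i ⌋ ∧ f c)) ⟩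
  ∑[ i < N ] ([ t i ] * count (λ c → ⌊ p c ≟ i ⌋ ∧ f c))   ≡⟨ sum-cong-≗ (λ i → cong ([ t i ] *_) (fibres i)) ⟩
  ∑[ i < N ] ([ t i ] * y)                                 ≡⟨ sym (*-distribʳ-sum y (λ i → [ t i ])) ⟩
  (∑[ i < N ] [ t i ]) * y                                 ≡⟨ cong (_* y) (sym (count-sum t)) ⟩
  count t * y                                              ∎
  where
  restrict : ∀ i c → ⌊ p c ≟ i ⌋ ∧ (t (p c) ∧ f c) ≡ t i ∧ (⌊ p c ≟ i ⌋ ∧ f c)
  restrict i c with p c ≟ i
  ... | yes refl = refl
  ... | no  _    = sym (∧-zeroʳ (t i))

count-∘-involution : (σ : Fin n → Fin n) → (∀ r → σ (σ r) ≡ r) →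
  (f : Fin n → Bool) → count f ≡ count (f ∘ σ)
count-∘-involution σ σ∘σ f = begin
  count f                     ≡⟨ count-sum f ⟩
  sum (λ i → [ f i ])         ≡⟨ sum-permute _ (permutation σ σ σ∘σ σ∘σ) ⟩
  sum (λ i → [ f (σ i) ])     ≡⟨ sym (count-sum (f ∘ σ)) ⟩
  count (f ∘ σ)               ∎

count₂-rows : (f : Fin m → Fin n → Bool) → ∀ {K} → (∀ r → count (f r) ≡ K) → count₂ f ≡ m * K
count₂-rows {zero}  f _     = refl
count₂-rows {suc m} f rows = cong₂ _+_ (rows zero) (count₂-rows (f ∘ suc) (rows ∘ suc))

∧-half⇒∧-not-half : (f g : Fin n → Bool) → count f ≡ q * 2 →
  count (λ c → f c ∧ g c) ≡ q → count (λ c → f c ∧ not (g c)) ≡ q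
∧-half⇒∧-not-half {q = q} f g total half = +-cancelˡ-≡ q _ _ (begin
  q + count (λ c → f c ∧ not (g c))                         ≡⟨ cong (_+ _) half ⟨
  count (λ c → f c ∧ g c) + count (λ c → f c ∧ not (g c))   ≡⟨ count-∧-split f g ⟨
  count f                                                   ≡⟨ total ⟩
  q * 2                                                     ≡⟨ *2≡+ q ⟩
  q + q                                                     ∎)

Balanced : (Fin n → Bool) → Set
Balanced {n} g = count g ≡ n / 2 × count (not ∘ g) ≡ n / 2

RowOrthogonal : (g f : Fin n → Bool) → Set
RowOrthogonal {n} g f = ∀ a b → count (λ c → ⌊ g c ≟ᵇ a ⌋ ∧ ⌊ f c ≟ᵇ b ⌋) ≡ n / 4

count≡half⇒Balanced : 2 ∣ n → {g : Fin n → Bool} → count g ≡ n / 2 → Balanced g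
count≡half⇒Balanced {n} (divides q n≡q*2) {g} count-g =
  count-g ,
  trans (∧-half⇒∧-not-half {q = q} (λ _ → true) g (trans (count-true {n}) n≡q*2) (trans count-g n/2≡q))
        (sym n/2≡q)
  where n/2≡q = m≡q*d⇒m/d≡q q n≡q*2

count≡count-not⇒Balanced : {g : Fin n → Bool} → count g ≡ count (not ∘ g) → Balanced g
count≡count-not⇒Balanced {n} {g} symmetric = half , trans (sym symmetric) half
  where
  half : count g ≡ n / 2
  half = sym (m≡q*d⇒m/d≡q (count g) (begin
    n                              ≡⟨ count-true {n} ⟨
    count {n} (λ _ → true)         ≡⟨ count-∧-split (λ _ → true) g ⟩
    count g + count (not ∘ g)      ≡⟨ cong (count g +_) symmetric ⟨
    count g + count g              ≡⟨ *2≡+ (count g) ⟨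
    count g * 2                    ∎))

Balanced-not : {g : Fin n → Bool} → Balanced g → Balanced (not ∘ g)
Balanced-not {g = g} (ones , zeros) = zeros , trans (count-cong (not-involutive ∘ g)) ones

RowOrthogonal-not : {g f : Fin n → Bool} → RowOrthogonal g f → RowOrthogonal (not ∘ g) f
RowOrthogonal-not {g = g} {f} orth a b =
  trans (count-cong (λ c → cong (_∧ ⌊ f c ≟ᵇ b ⌋) (not-≟ᵇ (g c) a))) (orth (not a) b)

-- Inclusion–exclusion: one cell and the two margins determine the other three cells.
margins⇒RowOrthogonal : {h G : Fin n → Bool} → n ≡ q * 4 → count h ≡ q * 2 → count G ≡ q * 2 →
  count (λ c → h c ∧ G c) ≡ q → RowOrthogonal h G
margins⇒RowOrthogonal {n} {q} {h} {G} n≡q*4 count-h count-G h∧G a b = begin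
  count (λ c → ⌊ h c ≟ᵇ a ⌋ ∧ ⌊ G c ≟ᵇ b ⌋)  ≡⟨ count-cong (λ c → cong₂ _∧_ (≟ᵇ-is (h c) a) (≟ᵇ-is (G c) b)) ⟩
  count (λ c → (h c is a) ∧ (G c is b))      ≡⟨ cell a b ⟩
  q                                          ≡⟨ m≡q*d⇒m/d≡q q n≡q*4 ⟨
  n / 4                                      ∎
  where
  G∧h : count (λ c → G c ∧ h c) ≡ q
  G∧h = trans (count-cong (λ c → ∧-comm (G c) (h c))) h∧G
  ¬h∧G : count (λ c → not (h c) ∧ G c) ≡ q
  ¬h∧G = trans (count-cong (λ c → ∧-comm (not (h c)) (G c))) (∧-half⇒∧-not-half G h count-G G∧h)
  count-¬h : count (not ∘ h) ≡ q * 2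
  count-¬h = ∧-half⇒∧-not-half (λ _ → true) h
    (trans (count-true {n}) (trans n≡q*4 (sym (*-assoc q 2 2)))) count-h
  cell : ∀ a b → count (λ c → (h c is a) ∧ (G c is b)) ≡ q
  cell true  true  = h∧G
  cell true  false = ∧-half⇒∧-not-half h G count-h h∧G
  cell false true  = ¬h∧G
  cell false false = ∧-half⇒∧-not-half (not ∘ h) G count-¬h ¬h∧G

module _ (P : Equipartition n) where
  open Equipartition P

  firstHalf : Fin n → Bool
  firstHalf c = toℕ (part c) <ᵇ numParts / 2

  count-firstHalf-∧ : {f : Fin n → Bool} → ∀ {y} →
    (∀ i → count (λ c → ⌊ part c ≟ i ⌋ ∧ f c) ≡ y) →
    count (λ c → firstHalf c ∧ f c) ≡ numParts / 2 * y
  count-firstHalf-∧ {f} {y} fibres =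
    trans (count-uniform-fibres part _ f fibres) (cong (_* y) (count-<ᵇ (m/n≤m numParts 2)))

  parts : ∀ i → count (λ c → ⌊ part c ≟ i ⌋ ∧ true) ≡ partSize
  parts i = trans (count-cong (λ c → ∧-identityʳ ⌊ part c ≟ i ⌋)) (sizes i)

  n≡numParts*partSize : n ≡ numParts * partSize
  n≡numParts*partSize = begin
    n                                  ≡⟨ count-true {n} ⟨
    count {n} (λ _ → true)             ≡⟨ count-uniform-fibres part (λ _ → true) (λ _ → true) parts ⟩
    count {numParts} (λ _ → true) * partSize ≡⟨ cong (_* partSize) (count-true {numParts}) ⟩
    numParts * partSize                ∎

  module _ {a b} (numParts≡a*2 : numParts ≡ a * 2) (partSize≡b*2 : partSize ≡ b * 2) where

    n≡a*b*4 : n ≡ a * b * 4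
    n≡a*b*4 = trans n≡numParts*partSize (trans (cong₂ _*_ numParts≡a*2 partSize≡b*2) (lemma a b))
      where
      lemma : ∀ a b → a * 2 * (b * 2) ≡ a * b * 4
      lemma = solve-∀

    n≡a*b*2*2 : n ≡ a * b * 2 * 2
    n≡a*b*2*2 = trans n≡a*b*4 (sym (*-assoc (a * b) 2 2))

    n/2≡a*b*2 : n / 2 ≡ a * b * 2
    n/2≡a*b*2 = m≡q*d⇒m/d≡q (a * b * 2) n≡a*b*2*2

    count-firstHalf : count firstHalf ≡ a * b * 2
    count-firstHalf = begin
      count firstHalf                       ≡⟨ count-cong (λ c → ∧-identityʳ (firstHalf c)) ⟨
      count (λ c → firstHalf c ∧ true)      ≡⟨ count-firstHalf-∧ parts ⟩
      numParts / 2 * partSize               ≡⟨ cong₂ _*_ (m≡q*d⇒m/d≡q a numParts≡a*2) partSize≡b*2 ⟩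
      a * (b * 2)                           ≡⟨ *-assoc a b 2 ⟨
      a * b * 2                             ∎

    firstHalf-Balanced : Balanced firstHalf
    firstHalf-Balanced = count≡half⇒Balanced (divides (a * b * 2) n≡a*b*2*2)
      (trans count-firstHalf (sym n/2≡a*b*2))

    firstHalf-RowOrthogonal : {G : Fin n → Bool} → count G ≡ n / 2 →
      (∀ i → count (λ c → ⌊ part c ≟ i ⌋ ∧ G c) ≡ partSize / 2) → RowOrthogonal firstHalf G
    firstHalf-RowOrthogonal count-G halves =
      margins⇒RowOrthogonal n≡a*b*4 count-firstHalf (trans count-G n/2≡a*b*2)
        (trans (count-firstHalf-∧ halves)
          (cong₂ _*_ (m≡q*d⇒m/d≡q a numParts≡a*2) (m≡q*d⇒m/d≡q b partSize≡b*2)))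

  even-equipartition-4∣ : 2 ∣ numParts → 2 ∣ partSize → 4 ∣ n
  even-equipartition-4∣ (divides a numParts≡a*2) (divides b partSize≡b*2) =
    divides (a * b) (n≡a*b*4 {a} {b} numParts≡a*2 partSize≡b*2)

Admissible : ∀ {k} → (Fin k → Square n) → Fin n → (Fin n → Bool) → Set
Admissible F ρ g = Balanced g × (∀ j → RowOrthogonal g (F j ρ))

Admissible-not : ∀ {k} {F : Fin k → Square n} {ρ g} → Admissible F ρ g → Admissible F ρ (not ∘ g)
Admissible-not {n} {g = g} (balanced , orth) =
  Balanced-not {n} {g} balanced , λ j → RowOrthogonal-not {n} {g} (orth j)

RowOrthogonal⇒Orthogonal : 4 ∣ n → {F G : Square n} →
  (∀ r → RowOrthogonal (F r) (G r)) → Orthogonal n F G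
RowOrthogonal⇒Orthogonal {n} 4∣n orth a b =
  trans (count₂-rows _ (λ r → orth r a b)) (sym (*-/-assoc n 4∣n))

module PairedSquare {k} (F : Fin k → Square n) {σ : Fin n → Fin n} (pairing : IsPairing σ)
  (row : Fin n → Fin n → Bool)
  (row-admissible : ∀ r → Admissible F r (row r) × Admissible F (σ r) (row r)) where

  σ∘σ : ∀ r → σ (σ r) ≡ r
  σ∘σ = proj₁ pairing

  leader : Fin n → Bool
  leader r = toℕ r <ᵇ toℕ (σ r)

  leader-σ : ∀ r → leader (σ r) ≡ not (leader r)
  leader-σ r = trans (cong (λ s → toℕ (σ r) <ᵇ toℕ s) (σ∘σ r))
    (<ᵇ-flip (toℕ r) (toℕ (σ r)) (λ e → proj₂ pairing r (toℕ-injective (sym e))))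

  pairRow : Bool → Fin n → Fin n → Bool
  pairRow true  r = row r
  pairRow false r = not ∘ row (σ r)

  F′ : Square n
  F′ r = pairRow (leader r) r

  F′-σ : ∀ r c → F′ (σ r) c ≡ not (F′ r c)
  F′-σ r c = trans (cong (λ b → pairRow b (σ r) c) (leader-σ r)) (flip (leader r))
    where
    flip : ∀ b → pairRow (not b) (σ r) c ≡ not (pairRow b r c)
    flip true  = cong (λ s → not (row s c)) (σ∘σ r)
    flip false = sym (not-involutive _)

  pairRow-admissible : ∀ b r → Admissible F r (pairRow b r)
  pairRow-admissible true  r = proj₁ (row-admissible r)
  pairRow-admissible false r =
    Admissible-not {F = F} (subst (λ ρ → Admissible F ρ (row (σ r))) (σ∘σ r) (proj₂ (row-admissible (σ r))))

  F′-admissible : ∀ r → Admissible F r (F′ r)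
  F′-admissible r = pairRow-admissible (leader r) r

  F′-IsBFS : IsBFS n F′
  F′-IsBFS = proj₁ ∘ F′-admissible , λ c → count≡count-not⇒Balanced {n} {λ r → F′ r c}
    (trans (count-∘-involution σ σ∘σ (λ r → F′ r c)) (count-cong (λ r → F′-σ r c)))

lemma3p4 : (n k : ℕ) → 2 ∣ n →
    (F : Fin k → Square n) → (∀ j → IsBFS n (F j)) →
    (σ : Fin n → Fin n) → IsPairing σ →
    (∀ r → ∃[ P ] (∀ j → Good P r (F j) × Good P (σ r) (F j))) →
    ∃[ F′ ] (IsBFS n F′ × (∀ j → Orthogonal n F′ (F j)))
lemma3p4 n zero 2∣n F _ σ pairing _ = F′ , F′-IsBFS , λ ()
  where
  prefix : Fin n → Bool
  prefix c = toℕ c <ᵇ n / 2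
  prefix-admissible : ∀ ρ → Admissible F ρ prefix
  prefix-admissible _ = count≡half⇒Balanced 2∣n (count-<ᵇ (m/n≤m n 2)) , λ ()
  open PairedSquare F pairing (λ _ → prefix) (λ r → prefix-admissible r , prefix-admissible (σ r))
lemma3p4 n (suc k) _ F F-IsBFS σ pairing good =
  F′ , F′-IsBFS , λ j → RowOrthogonal⇒Orthogonal 4∣n {F′} (λ r → proj₂ (F′-admissible r) j)
  where
  P : Fin n → Equipartition n
  P r = proj₁ (good r)
  firstHalf-admissible : ∀ r {ρ} → (∀ j → Good (P r) ρ (F j)) → Admissible F ρ (firstHalf (P r))
  firstHalf-admissible r {ρ} good-ρ with good-ρ zero
  ... | divides a numParts≡ , divides b partSize≡ , _ =
    firstHalf-Balanced (P r) {a} {b} numParts≡ partSize≡ ,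
    λ j → firstHalf-RowOrthogonal (P r) {a} {b} numParts≡ partSize≡
      (proj₁ (proj₁ (F-IsBFS j) ρ)) (proj₂ (proj₂ (good-ρ j)))
  open PairedSquare F pairing (firstHalf ∘ P)
    (λ r → firstHalf-admissible r (proj₁ ∘ proj₂ (good r)) ,
           firstHalf-admissible r (proj₂ ∘ proj₂ (good r)))
  4∣n : 4 ∣ n
  4∣n = inhabited-∣ λ r → let (even-parts , even-size , _) = proj₁ (proj₂ (good r) zero)
                           in even-equipartition-4∣ (P r) even-parts even-size
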